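{- Let $\mathbb{X}_+=\{X_1,X_2,\dots\}$ and $\mathbb{X}_{+2}=\{X_2,X_3,\dots\}$. Then: (i) the K-dual of the linked language $\mathscr{C}^{(1)}$ (over $\mathbb{X}_+$ with links $B=\{(X_i,X_j):j-i\le1\}$) is $\mathcal{P}_2$; (ii) the K-dual of the linked language $\sigma\mathscr{C}^{(1)}$ (over $\mathbb{X}_{+2}$ with links $\{(X_i,X_j):j-i\le 1,\ i,j\ge2\}$) is $\sigma\mathcal{P}_2$; (iii) the K-dual of the right $\mathscr{C}^{(1)}$-module $N$ of nonempty compositions with risings at most $1$ and first part at least $2$ (with $\mathbb{A}_1=\mathbb{X}_{+2}$ and links $C=\{(X_i,X_j):i\ge2,\ j\ge1,\ j-i\le1\}$) is the language $\mathcal{N}=\sigma\mathcal{P}_2-1$ of nonempty $2$-distinct partitions with first part at least $2$.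
   Context: A word $X_{\kappa_1}\cdots X_{\kappa_m}$ is identified with the sequence $\kappa$. $\mathscr{C}^{(1)}$ is the language of (strong) compositions $\kappa$ (all parts $\ge1$, empty composition included) with $\kappa_{i+1}-\kappa_i\le 1$ for all $i$; $\sigma\mathscr{C}^{(1)}$ is the set of those with all parts $\ge2$. $\mathcal{P}_2$ is the language of words $X_{\lambda_1}\cdots X_{\lambda_l}$ with $1\le\lambda_1$ and $\lambda_{i+1}-\lambda_i\ge2$ (empty word included); $\sigma\mathcal{P}_2$ is the subset with all parts $\ge2$. For an alphabet $\mathbb{A}$ and links $B\subseteq\mathbb{A}\times\mathbb{A}$, the linked language is the set of words all of whose consecutive letter pairs lie in $B$ (empty and one-letter words included), and its K-dual is the linked language for $B^c=(\mathbb{A}\times\mathbb{A})\setminus B$. For $\mathbb{A}_1\subseteq\mathbb{A}$ and $C\subseteq\mathbb{A}_1\times\mathbb{A}$, the module $N$ is the set of nonempty words with first letter in $\mathbb{A}_1$, first pair in $C$ and later pairs in $B$; its K-dual is defined with $C^c=(\mathbb{A}_1\times\mathbb{A})\setminus C$ and $B^c$. -}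

module Defs where

open import Data.Nat using (ℕ; _≤_; _+_; suc)
open import Data.List using (List; []; _∷_)
open import Data.List.Relation.Unary.All using (All)
open import Data.List.Relation.Unary.Linked using (Linked)
open import Data.Product using (_×_)
open import Data.Empty using (⊥)
open import Data.Unit using (⊤)
open import Relation.Nullary using (¬_)
open import Relation.Binary.PropositionalEquality using (_≢_)
open import Function.Bundles using (_⇔_)

-- A letter X_i is represented by its index i : ℕ; a word X_{κ1}⋯X_{κm}
-- is the list κ = κ1 ∷ ⋯ ∷ κm.
Word : Set
Word = List ℕ

Language : Set₁
Language = Word → Set

Alphabet : Set₁
Alphabet = ℕ → Set

Links : Set₁
Links = ℕ → ℕ → Set

compl : Alphabet → Alphabet → Links → Links
compl A₁ A B x y = A₁ x × A y × ¬ B x y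

LinkedLang : Alphabet → Links → Language
LinkedLang A B w = All A w × Linked B w

KDual : Alphabet → Links → Language
KDual A B = LinkedLang A (compl A A B)

ModuleLang : Alphabet → Alphabet → Links → Links → Language
ModuleLang A A₁ C B []           = ⊥
ModuleLang A A₁ C B (x ∷ [])     = A₁ x × A x
ModuleLang A A₁ C B (x ∷ y ∷ w)  = A₁ x × A x × C x y × All A (y ∷ w) × Linked B (y ∷ w)

ModuleKDual : Alphabet → Alphabet → Links → Links → Language
ModuleKDual A A₁ C B = ModuleLang A A₁ (compl A₁ A C) (compl A A B)

_≈L_ : Language → Language → Set
L ≈L M = ∀ w → L w ⇔ M w

𝕏₊ : Alphabet
𝕏₊ i = 1 ≤ i

𝕏₊₂ : Alphabet
𝕏₊₂ i = 2 ≤ i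

B₁ : Links
B₁ i j = 1 ≤ i × 1 ≤ j × j ≤ suc i

σB₁ : Links
σB₁ i j = 2 ≤ i × 2 ≤ j × j ≤ suc i

C₁ : Links
C₁ i j = 2 ≤ i × 1 ≤ j × j ≤ suc i

HeadSat : (ℕ → Set) → Word → Set
HeadSat P []      = ⊤
HeadSat P (x ∷ _) = P x

Gap2 : Links
Gap2 i j = i + 2 ≤ j

𝒫₂ : Language
𝒫₂ w = HeadSat (1 ≤_) w × Linked Gap2 w

σ𝒫₂ : Language
σ𝒫₂ w = 𝒫₂ w × All (2 ≤_) w

𝒩 : Language
𝒩 w = w ≢ [] × σ𝒫₂ w

-- Over an alphabet of letters ≥ k, a pair (Xᵢ, Xⱼ) fails the link j - i ≤ 1
-- exactly when j - i ≥ 2, so the K-dual links are the 2-distinct-partition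
-- links. Such words are strictly increasing, hence a lower bound on the first
-- part bounds every part, and the alphabet condition of the K-dual reduces to
-- the condition on the first part that defines 𝒫₂, σ𝒫₂ and 𝒩.
module Submission where

open import Defs
open import Data.Product using (_×_; _,_)
open import Data.Nat using (ℕ; _≤_; suc; s≤s; z≤n)
open import Data.Nat.Properties using (≰⇒>; <⇒≱; ≤-trans; m≤n+m; +-comm)
open import Data.List using ([]; _∷_)
open import Data.List.Relation.Unary.All as All using (All; []; _∷_)
open import Data.List.Relation.Unary.Linked as Linked using (Linked; []; [-]; _∷_)
open import Data.List.Relation.Unary.Linked.Properties using (Linked⇒All)
open import Data.Unit using (tt)
open import Data.Empty using (⊥-elim)
open import Relation.Nullary using (¬_)
open import Relation.Binary.PropositionalEquality using (refl; subst)
open import Function.Bundles using (_⇔_; mk⇔; Equivalence)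

¬≤1+⇔Gap2 : ∀ {i j} → (¬ j ≤ suc i) ⇔ Gap2 i j
¬≤1+⇔Gap2 {i} {j} = mk⇔
  (λ j≰1+i → subst (_≤ j) (+-comm 2 i) (≰⇒> j≰1+i))
  (λ i+2≤j → <⇒≱ (subst (_≤ j) (+-comm i 2) i+2≤j))

Gap2⇒≤ : ∀ {i j} → Gap2 i j → i ≤ j
Gap2⇒≤ {i} {j} i+2≤j = ≤-trans (m≤n+m i 2) (subst (_≤ j) (+-comm i 2) i+2≤j)

head⇒All : ∀ {k} w → HeadSat (k ≤_) w → Linked Gap2 w → All (k ≤_) w
head⇒All []      _   _       = []
head⇒All (_ ∷ _) k≤x gapped = Linked⇒All ≤-trans k≤x (Linked.map Gap2⇒≤ gapped)

All⇒head : ∀ {P : ℕ → Set} {w} → All P w → HeadSat P w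
All⇒head []      = tt
All⇒head (p ∷ _) = p

RisesAtMostOne : Alphabet → Alphabet → Links → Set
RisesAtMostOne A₁ A B = ∀ {i j} → A₁ i → A j → B i j ⇔ j ≤ suc i

module _ {A₁ A : Alphabet} {B : Links} (rises : RisesAtMostOne A₁ A B) where

  compl⇒Gap2 : ∀ {i j} → compl A₁ A B i j → Gap2 i j
  compl⇒Gap2 (a₁ , a , ¬B) =
    Equivalence.to ¬≤1+⇔Gap2 (λ j≤1+i → ¬B (Equivalence.from (rises a₁ a) j≤1+i))

  Gap2⇒compl : ∀ {i j} → A₁ i → A j → Gap2 i j → compl A₁ A B i j
  Gap2⇒compl a₁ a gap =
    a₁ , a , λ b → Equivalence.from ¬≤1+⇔Gap2 gap (Equivalence.to (rises a₁ a) b)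

linked-compl⇒Gap2 : ∀ {A : Alphabet} {B : Links} → RisesAtMostOne A A B →
                    ∀ {w} → Linked (compl A A B) w → Linked Gap2 w
linked-compl⇒Gap2 rises = Linked.map (compl⇒Gap2 rises)

linked-Gap2⇒compl : ∀ {A : Alphabet} {B : Links} → RisesAtMostOne A A B →
                    ∀ {w} → All A w → Linked Gap2 w → Linked (compl A A B) w
linked-Gap2⇒compl rises []              []           = []
linked-Gap2⇒compl rises (_ ∷ [])        [-]          = [-]
linked-Gap2⇒compl rises (a ∷ a′ ∷ as) (gap ∷ gaps) =
  Gap2⇒compl rises a a′ gap ∷ linked-Gap2⇒compl rises (a′ ∷ as) gaps

KDual⇔head×Gap2 : ∀ {k} {B : Links} → RisesAtMostOne (k ≤_) (k ≤_) B →
                  ∀ w → KDual (k ≤_) B w ⇔ (HeadSat (k ≤_) w × Linked Gap2 w)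
KDual⇔head×Gap2 rises w = mk⇔
  (λ (bounded , linked) → All⇒head bounded , linked-compl⇒Gap2 rises linked)
  (λ (head , gapped) →
    let bounded = head⇒All w head gapped
    in bounded , linked-Gap2⇒compl rises bounded gapped)

rises-B₁ : RisesAtMostOne 𝕏₊ 𝕏₊ B₁
rises-B₁ 1≤i 1≤j = mk⇔ (λ (_ , _ , j≤1+i) → j≤1+i) (λ j≤1+i → 1≤i , 1≤j , j≤1+i)

rises-σB₁ : RisesAtMostOne 𝕏₊₂ 𝕏₊₂ σB₁
rises-σB₁ 2≤i 2≤j = mk⇔ (λ (_ , _ , j≤1+i) → j≤1+i) (λ j≤1+i → 2≤i , 2≤j , j≤1+i)

rises-C₁ : RisesAtMostOne 𝕏₊₂ 𝕏₊ C₁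
rises-C₁ 2≤i 1≤j = mk⇔ (λ (_ , _ , j≤1+i) → j≤1+i) (λ j≤1+i → 2≤i , 1≤j , j≤1+i)

2≤⇒1≤ : ∀ {i} → 2 ≤ i → 1 ≤ i
2≤⇒1≤ (s≤s _) = s≤s z≤n

KDual-𝒞⁽¹⁾ : KDual 𝕏₊ B₁ ≈L 𝒫₂
KDual-𝒞⁽¹⁾ = KDual⇔head×Gap2 rises-B₁

KDual-σ𝒞⁽¹⁾ : KDual 𝕏₊₂ σB₁ ≈L σ𝒫₂
KDual-σ𝒞⁽¹⁾ w = mk⇔
  (λ dual@(bounded , _) → let (_ , gapped) = to dual
    in (All⇒head (All.map 2≤⇒1≤ bounded) , gapped) , bounded)
  (λ ((_ , gapped) , bounded) → from (All⇒head bounded , gapped))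
  where open Equivalence (KDual⇔head×Gap2 rises-σB₁ w)

ModuleKDual-N : ModuleKDual 𝕏₊ 𝕏₊₂ C₁ B₁ ≈L 𝒩
ModuleKDual-N v = mk⇔ (to v) (from v)
  where
  to : ∀ w → ModuleKDual 𝕏₊ 𝕏₊₂ C₁ B₁ w → 𝒩 w
  to (x ∷ [])    (2≤x , 1≤x) = (λ ()) , (1≤x , [-]) , (2≤x ∷ [])
  to (x ∷ y ∷ w) (2≤x , 1≤x , first , _ , linked) =
    let gapped = compl⇒Gap2 rises-C₁ first ∷ linked-compl⇒Gap2 rises-B₁ linked
    in (λ ()) , (1≤x , gapped) , head⇒All (x ∷ y ∷ w) 2≤x gapped

  from : ∀ w → 𝒩 w → ModuleKDual 𝕏₊ 𝕏₊₂ C₁ B₁ w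
  from []          (nonempty , _)                 = ⊥-elim (nonempty refl)
  from (x ∷ [])    (_ , _ , (2≤x ∷ []))           = 2≤x , 2≤⇒1≤ 2≤x
  from (x ∷ y ∷ w) (_ , (_ , (gap ∷ gaps)) , (2≤x ∷ bounded)) =
    let positive = All.map 2≤⇒1≤ bounded
    in 2≤x , 2≤⇒1≤ 2≤x , Gap2⇒compl rises-C₁ 2≤x (All⇒head positive) gap
     , positive , linked-Gap2⇒compl rises-B₁ positive gaps

mainTheorem5 : (KDual 𝕏₊ B₁ ≈L 𝒫₂) × (KDual 𝕏₊₂ σB₁ ≈L σ𝒫₂) × (ModuleKDual 𝕏₊ 𝕏₊₂ C₁ B₁ ≈L 𝒩)
mainTheorem5 = KDual-𝒞⁽¹⁾ , KDual-σ𝒞⁽¹⁾ , ModuleKDual-N
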